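{- Let $(X,T)$ be a minimal subshift satisfying $1\le p_X(n+1)-p_X(n)\le2$ for all $n$, and let $(U_n)_{n\ge N}$ be a sequence of right special factors of $X$ with $|U_n|=n$ and $U_n$ a suffix of $U_{n+1}$ for all $n\ge N$. Then for every $n\ge N$ there are at most $3$ allowed $n$-circuits starting from $U_n$ in the Rauzy graph $G_n$.
   Context: $p_X(n)$ is the number of words of length $n$ in the language $\mathcal L(X)$; a word $u$ is right special if $ua,ub\in\mathcal L(X)$ for two distinct letters $a,b$. The Rauzy graph $G_n$ has vertex set $\mathcal L_n(X)$ and an edge from $u$ to $v$ with right label $b$ whenever $ub=av\in\mathcal L_{n+1}(X)$ for letters $a,b$. A path $u_0\to\cdots\to u_\ell$ with right labels $b_1,\dots,b_\ell$ is allowed if $u_0b_1\cdots b_\ell\in\mathcal L(X)$. An $n$-circuit is a non-empty path in $G_n$ whose origin equals its end, this vertex being right special, and no interior vertex of which equals its origin. -}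

module Defs where

open import Data.Nat using (ℕ; zero; suc; _+_; _≤_; _<_)
open import Data.Integer as ℤ using (ℤ; 1ℤ; -1ℤ)
open import Data.Fin using (Fin)
open import Data.List using (List; []; _∷_; _++_; [_]; length; take; drop)
open import Data.List.Membership.Propositional using (_∈_)
open import Data.List.Relation.Unary.All using (All)
open import Data.List.Relation.Unary.Unique.Propositional using (Unique)
open import Data.Product using (Σ; ∃; _×_; _,_)
open import Relation.Binary.PropositionalEquality using (_≡_; _≢_)

Conf : ℕ → Set
Conf k = ℤ → Fin k

ConfSet : ℕ → Set₁
ConfSet k = Conf k → Set

Word : ℕ → Set
Word k = List (Fin k)

window : ∀ {k} → Conf k → ℤ → ℕ → Word k
window x i zero    = []
window x i (suc m) = x i ∷ window x (i ℤ.+ 1ℤ) m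

shift : ∀ {k} → Conf k → Conf k
shift x i = x (i ℤ.+ 1ℤ)

unshift : ∀ {k} → Conf k → Conf k
unshift x i = x (i ℤ.+ -1ℤ)

Lang : ∀ {k} → ConfSet k → Word k → Set
Lang X w = ∃ λ x → X x × ∃ λ i → window x i (length w) ≡ w

-- closed in the product topology: contains every point all of whose
-- finite windows occur in it
IsClosed : ∀ {k} → ConfSet k → Set
IsClosed X = ∀ x → (∀ i m → Lang X (window x i m)) → X x

IsInvariant : ∀ {k} → ConfSet k → Set
IsInvariant X = ∀ x → X x → X (shift x) × X (unshift x)

Nonempty : ∀ {k} → ConfSet k → Set
Nonempty X = ∃ λ x → X x

IsSubshift : ∀ {k} → ConfSet k → Set
IsSubshift X = Nonempty X × IsClosed X × IsInvariant X

IsMinimalSubshift : ∀ {k} → ConfSet k → Set₁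
IsMinimalSubshift {k} X =
  IsSubshift X ×
  ((Y : ConfSet k) → (∀ x → Y x → X x) → IsSubshift Y → ∀ x → X x → Y x)

-- p_X(n) = m : the words of length n of L(X) are exactly the m
-- (distinct) entries of some list
Complexity : ∀ {k} → ConfSet k → ℕ → ℕ → Set
Complexity {k} X n m =
  Σ (List (Word k)) λ ws →
    length ws ≡ m × Unique ws ×
    All (λ w → length w ≡ n × Lang X w) ws ×
    (∀ w → length w ≡ n → Lang X w → w ∈ ws)

RightSpecial : ∀ {k} → ConfSet k → Word k → Set
RightSpecial {k} X u =
  Σ (Fin k) λ a → Σ (Fin k) λ b → a ≢ b × Lang X (u ++ [ a ]) × Lang X (u ++ [ b ])

-- The path in G_n starting at u with right labels w = b_1 ... b_ℓ has
-- vertices u_i = drop i (u ++ take i w) (the last n letters of u b_1...b_i).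
vertex : ∀ {k} → Word k → Word k → ℕ → Word k
vertex u w i = drop i (u ++ take i w)

-- Edge u_{i-1} → u_i with right label b_i in G_n : u_{i-1} b_i ∈ L_{n+1}(X)
IsPath : ∀ {k} → ConfSet k → Word k → Word k → Set
IsPath X u w = ∀ i → i < length w →
  Σ _ λ b → drop i w ≡ b ∷ drop (suc i) w × Lang X (vertex u w i ++ [ b ])

-- An allowed n-circuit starting from u (|u| = n), given by its right labels w:
-- a non-empty path in G_n from u (a vertex of G_n) back to u, u right special,
-- no interior vertex equal to u, and allowed: u b_1 ... b_ℓ ∈ L(X).
AllowedCircuit : ∀ {k} → ConfSet k → ℕ → Word k → Word k → Set
AllowedCircuit X n u w =
  length u ≡ n × Lang X u × RightSpecial X u ×
  1 ≤ length w × IsPath X u w ×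
  vertex u w (length w) ≡ u ×
  (∀ i → 1 ≤ i → i < length w → vertex u w i ≢ u) ×
  Lang X (u ++ w)

-- A finite set of distinct allowed circuits from u = U_n is a prefix code: a circuit returns to u
-- only at its end, so no circuit is a proper prefix of another, and the circuits are the leaves of a
-- trie.  If a node p of the trie has d children, then u p is a factor with at least d right
-- extensions.  The bound p(M+1) - p(M) <= 2 says that the excesses (right extensions - 1) of the
-- factors of length M sum to at most 2.  For a node p /= [], the word u p meets at length n + |p| the
-- right special factor U_{n+|p|}, which ends with u and so differs from u p (u occurs in u p only at
-- its start), and the suffixes of that length of deeper nodes.  The resulting bounds on child counts
-- leave room for at most three leaves.

module Submission where

open import Defs
open import Data.Nat using (ℕ; zero; suc; _+_; _∸_; _≤_; _<_; z≤n; s≤s)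
open import Data.Nat.Properties
open import Data.Integer using (1ℤ) renaming (_+_ to _+ℤ_)
open import Data.Fin as Fin using (Fin)
open import Data.List using (List; []; _∷_; _++_; [_]; _∷ʳ_; length; take; drop; map; filter)
open import Data.Nat.ListAction using (sum)
open import Data.Nat.ListAction.Properties using (sum-++)
open import Data.List.Properties
  using (≡-dec; length-++; length-++-≤ʳ; length-map; length-drop; length-removeAt′; take++drop≡id; take-all;
         ++-assoc; ++-identityʳ; ++-identityʳ-unique; ++-identityˡ-unique; ++-cancelˡ; map-++;
         ∷-injective; ∷-injectiveˡ; ∷-injectiveʳ; ∷ʳ-injectiveˡ; ∷ʳ-injectiveʳ; ∷ʳ-++)
open import Data.List.Membership.Propositional using (_∈_)
open import Data.List.Membership.Propositional.Properties
  using (∈-map⁻; ∈-++⁻; ∈-++⁺ˡ; ∈-++⁺ʳ; ∈-filter⁺; ∈-filter⁻)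
open import Data.List.Relation.Unary.Any using (here; there; _─_)
open import Data.List.Relation.Unary.All as All using (All; []; _∷_)
import Data.List.Relation.Unary.All.Properties as All
open import Data.List.Relation.Unary.AllPairs using ([]; _∷_)
open import Data.List.Relation.Unary.Unique.Propositional using (Unique)
import Data.List.Relation.Unary.Unique.Propositional.Properties as Unique
open import Data.Product using (Σ; ∃; ∃₂; _×_; _,_; proj₁; proj₂)
open import Data.Sum using (inj₁; inj₂)
open import Data.Empty using (⊥; ⊥-elim)
open import Function using (_∘_; case_of_)
open import Relation.Nullary using (¬_; yes; no)
open import Relation.Binary using (DecidableEquality)
open import Relation.Binary.PropositionalEquality hiding ([_])

module _ {A : Set} where

  ∈-─ : ∀ {x y} {ys : List A} (x∈ys : x ∈ ys) → y ∈ ys → y ≢ x → y ∈ (ys ─ x∈ys)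
  ∈-─ (here refl) (here refl) y≢x = ⊥-elim (y≢x refl)
  ∈-─ (here refl) (there y∈ys) _  = y∈ys
  ∈-─ (there _)   (here refl) _   = here refl
  ∈-─ (there x∈ys) (there y∈ys) y≢x = there (∈-─ x∈ys y∈ys y≢x)

  Unique-⊆⇒length≤ : ∀ {xs ys : List A} → Unique xs → All (_∈ ys) xs → length xs ≤ length ys
  Unique-⊆⇒length≤ [] [] = z≤n
  Unique-⊆⇒length≤ {ys = ys} (x∉xs ∷ xs!) (x∈ys ∷ xs⊆ys) =
    subst (_ ≤_) (sym (length-removeAt′ ys _))
      (s≤s (Unique-⊆⇒length≤ xs! (All.zipWith (λ (y≢x , y∈ys) → ∈-─ x∈ys y∈ys (≢-sym y≢x)) (x∉xs , xs⊆ys))))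

  ++-injective : ∀ (xs ys : List A) {xs′ ys′} → length xs ≡ length ys →
                 xs ++ xs′ ≡ ys ++ ys′ → xs ≡ ys × xs′ ≡ ys′
  ++-injective []       []       _ eq = refl , eq
  ++-injective (x ∷ xs) (y ∷ ys) |xs|≡|ys| eq
    with refl , eq′ ← ∷-injective eq
    with refl , eq″ ← ++-injective xs ys (suc-injective |xs|≡|ys|) eq′ = refl , eq″

  levi : ∀ (xs us : List A) {ys vs} → xs ++ ys ≡ us ++ vs → length us ≤ length xs →
         ∃ λ w → xs ≡ us ++ w × vs ≡ w ++ ys
  levi xs       []       eq _ = xs , refl , sym eq
  levi (x ∷ xs) (u ∷ us) eq (s≤s |us|≤|xs|)
    with refl , eq′ ← ∷-injective eq
    with w , refl , refl ← levi xs us eq′ |us|≤|xs| = w , refl , refl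

  take-length-++ : ∀ (xs : List A) {ys} → take (length xs) (xs ++ ys) ≡ xs
  take-length-++ []       = refl
  take-length-++ (x ∷ xs) = cong (x ∷_) (take-length-++ xs)

  drop-length-++ : ∀ (xs : List A) {ys} → drop (length xs) (xs ++ ys) ≡ ys
  drop-length-++ []       = refl
  drop-length-++ (x ∷ xs) = drop-length-++ xs

  length-<-++ : ∀ (xs ys : List A) {y zs} → length xs < length ((xs ++ ys) ++ y ∷ zs)
  length-<-++ []       []       = s≤s z≤n
  length-<-++ []       (_ ∷ _)  = s≤s z≤n
  length-<-++ (_ ∷ xs) ys       = s≤s (length-<-++ xs ys)

  conjugate⇒same-length : ∀ {z u w : List A} → z ++ u ≡ u ++ w → length w ≡ length z
  conjugate⇒same-length {z} {u} {w} eq = +-cancelˡ-≡ (length u) _ _ (begin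
    length u + length w  ≡⟨ length-++ u ⟨
    length (u ++ w)      ≡⟨ cong length eq ⟨
    length (z ++ u)      ≡⟨ length-++ z ⟩
    length z + length u  ≡⟨ +-comm (length z) (length u) ⟩
    length u + length z  ∎)
    where open ≡-Reasoning

  suffix-chain : (U : ℕ → List A) (n : ℕ) → (∀ m → ∃ λ v → v ++ U (m + n) ≡ U (suc m + n)) →
                 ∀ m → ∃ λ v → v ++ U n ≡ U (m + n)
  suffix-chain U n step zero    = [] , refl
  suffix-chain U n step (suc m) =
    let v , v++Un≡ = suffix-chain U n step m
        v′ , v′++≡ = step m
    in v′ ++ v , trans (++-assoc v′ v (U n)) (trans (cong (v′ ++_) v++Un≡) v′++≡)

  suffix-of-length : ∀ {m} (xs : List A) → m ≤ length xs → ∃₂ λ z y → z ++ y ≡ xs × length y ≡ m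
  suffix-of-length {m} xs m≤|xs| =
    take j xs , drop j xs , take++drop≡id j xs , trans (length-drop j xs) (m∸[m∸n]≡n m≤|xs|)
    where j = length xs ∸ m

module _ {k : ℕ} where

  length-window : ∀ (c : Conf k) i m → length (window c i m) ≡ m
  length-window c i zero    = refl
  length-window c i (suc m) = cong suc (length-window c (i +ℤ 1ℤ) m)

  window-+ : ∀ (c : Conf k) i m l → ∃ λ j → window c i (m + l) ≡ window c i m ++ window c j l
  window-+ c i zero    l = i , refl
  window-+ c i (suc m) l = let j , eq = window-+ c (i +ℤ 1ℤ) m l in j , cong (c i ∷_) eq

  window-suc : ∀ (c : Conf k) i m → ∃ λ a → window c i (suc m) ≡ window c i m ∷ʳ a
  window-suc c i zero    = c i , refl
  window-suc c i (suc m) = let a , eq = window-suc c (i +ℤ 1ℤ) m in a , cong (c i ∷_) eq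

  totalDegree : List (Word k × List (Fin k)) → ℕ
  totalDegree rs = sum (map (length ∘ proj₂) rs)

  extensions : List (Word k × List (Fin k)) → List (Word k)
  extensions []              = []
  extensions ((r , as) ∷ rs) = map (r ∷ʳ_) as ++ extensions rs

  length-extensions : ∀ rs → length (extensions rs) ≡ totalDegree rs
  length-extensions []              = refl
  length-extensions ((r , as) ∷ rs) =
    trans (length-++ (map (r ∷ʳ_) as)) (cong₂ _+_ (length-map (r ∷ʳ_) as) (length-extensions rs))

  ∈-extensions⁻ : ∀ {y} rs → y ∈ extensions rs → ∃₂ λ r a → r ∈ map proj₁ rs × y ≡ r ∷ʳ a
  ∈-extensions⁻ ((r , as) ∷ rs) y∈ with ∈-++⁻ (map (r ∷ʳ_) as) y∈
  ... | inj₁ y∈as = let a , _ , y≡ = ∈-map⁻ (r ∷ʳ_) y∈as in r , a , here refl , y≡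
  ... | inj₂ y∈rs = let r′ , a , r′∈ , y≡ = ∈-extensions⁻ rs y∈rs in r′ , a , there r′∈ , y≡

module _ {k : ℕ} (X : ConfSet k) where

  window-Lang : ∀ {c i m w} → X c → window c i m ≡ w → Lang X w
  window-Lang {c} {i} {m} c∈X refl = c , c∈X , i , cong (window c i) (length-window c i m)

  Lang-++⁻ : ∀ xs {ys} → Lang X (xs ++ ys) → Lang X xs × Lang X ys
  Lang-++⁻ xs {ys} (c , c∈X , i , eq)
    with j , split ← window-+ c i (length xs) (length ys)
    with e₁ , e₂ ← ++-injective (window c i (length xs)) xs (length-window c i (length xs))
                     (trans (sym split) (trans (cong (window c i) (sym (length-++ xs))) eq))
    = window-Lang c∈X e₁ , window-Lang c∈X e₂

  Lang-∷ʳ : ∀ {xs} → Lang X xs → ∃ λ a → Lang X (xs ∷ʳ a)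
  Lang-∷ʳ {xs} (c , c∈X , i , eq) =
    let a , snoc = window-suc c i (length xs) in a , window-Lang c∈X (trans snoc (cong (_∷ʳ a) eq))

  Followers : Word k → List (Fin k) → Set
  Followers x as = Unique as × All (λ a → Lang X (x ∷ʳ a)) as

  Followers-suffix : ∀ z {y as} → Followers (z ++ y) as → Followers y as
  Followers-suffix z {y} (as! , Las) =
    as! , All.map (λ {a} L → proj₂ (Lang-++⁻ z (subst (Lang X) (++-assoc z y [ a ]) L))) Las

  specialFollowers : ∀ {x} → RightSpecial X x → List (Fin k)
  specialFollowers s = proj₁ s ∷ proj₁ (proj₂ s) ∷ []

  special-Followers : ∀ {x} (s : RightSpecial X x) → Followers x (specialFollowers s)
  special-Followers (a , b , a≢b , La , Lb) = ((a≢b ∷ []) ∷ [] ∷ []) , La ∷ Lb ∷ []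

  FollowersAt : ℕ → Word k × List (Fin k) → Set
  FollowersAt M (r , as) = length r ≡ M × Followers r as

  extensions-Unique : ∀ {M} rs → Unique (map proj₁ rs) → All (FollowersAt M) rs → Unique (extensions rs)
  extensions-Unique []              _              _ = []
  extensions-Unique ((r , as) ∷ rs) (r∉rs ∷ keys!) ((_ , as! , _) ∷ rows) =
    Unique.++⁺ (Unique.map⁺ (∷ʳ-injectiveʳ r r) as!) (extensions-Unique rs keys! rows) disjoint
    where
    disjoint : ∀ {y} → ¬ (y ∈ map (r ∷ʳ_) as × y ∈ extensions rs)
    disjoint (y∈as , y∈rs) with _ , _ , y≡ ← ∈-map⁻ (r ∷ʳ_) y∈as
                           with r′ , _ , r′∈rs , y≡′ ← ∈-extensions⁻ rs y∈rs =
      All.lookup r∉rs r′∈rs (∷ʳ-injectiveˡ r r′ (trans (sym y≡) y≡′))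

  Lang-extensions : ∀ {M} rs → All (FollowersAt M) rs →
                    All (λ y → length y ≡ suc M × Lang X y) (extensions rs)
  Lang-extensions []              [] = []
  Lang-extensions ((r , as) ∷ rs) ((|r| , _ , Las) ∷ rows) =
    All.++⁺ (All.map⁺ (All.map (λ {a} L → trans (length-++ r) (trans (+-comm _ 1) (cong suc |r|)) , L) Las))
            (Lang-extensions rs rows)

  totalDegree≤ : ∀ {M q} → Complexity X (suc M) q → ∀ rs → Unique (map proj₁ rs) →
                 All (FollowersAt M) rs → totalDegree rs ≤ q
  totalDegree≤ (ws , refl , _ , _ , complete) rs keys! rows =
    subst (_≤ length ws) (length-extensions rs)
      (Unique-⊆⇒length≤ (extensions-Unique rs keys! rows)
        (All.map (λ (|y| , Ly) → complete _ |y| Ly) (Lang-extensions rs rows)))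

  oneFollowerEach : ∀ {M} xs → All (λ x → length x ≡ M × Lang X x) xs →
    Σ (List (Word k × List (Fin k))) λ rs →
      map proj₁ rs ≡ xs × totalDegree rs ≡ length xs × All (FollowersAt M) rs
  oneFollowerEach []       []                = [] , refl , refl , []
  oneFollowerEach (x ∷ xs) ((|x| , Lx) ∷ Lxs) =
    let a , Lxa = Lang-∷ʳ Lx
        rs , keys≡ , degree≡ , rows = oneFollowerEach xs Lxs
    in (x , a ∷ []) ∷ rs , cong (x ∷_) keys≡ , cong suc degree≡ ,
       (|x| , ([] ∷ []) , Lxa ∷ []) ∷ rows

  open import Data.List.Membership.DecPropositional (≡-dec (Fin._≟_ {k})) using (_∈?_; _∉?_)

  -- Every word of length M outside the rows gets one follower; then the extensions of all rows are
  -- distinct words of length M + 1, and the keys of all rows cover the words of length M.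
  excess≤ : ∀ {M p q} → Complexity X M p → Complexity X (suc M) q → ∀ rs →
            Unique (map proj₁ rs) → All (FollowersAt M) rs → p + totalDegree rs ≤ q + length rs
  excess≤ {M} {q = q} (ws , refl , ws! , ws-ok , _) cM+1 rs keys! rows
    with os , keys-os , degree-os , rows-os ← oneFollowerEach (filter (_∉? map proj₁ rs) ws)
                                                (All.filter⁺ (_∉? map proj₁ rs) ws-ok) = begin
    length ws + D                        ≤⟨ +-monoˡ-≤ D covered ⟩
    (length rs + length others) + D      ≡⟨ +-assoc (length rs) _ D ⟩
    length rs + (length others + D)      ≡⟨ cong (length rs +_) (+-comm (length others) D) ⟩
    length rs + (D + length others)      ≤⟨ +-monoʳ-≤ (length rs) degree≤ ⟩
    length rs + q                        ≡⟨ +-comm (length rs) q ⟩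
    q + length rs                        ∎
    where
    open ≤-Reasoning
    D = totalDegree rs
    keys = map proj₁ rs
    others = filter (_∉? keys) ws
    unique-keys : Unique (map proj₁ (rs ++ os))
    unique-keys = subst Unique (sym (trans (map-++ proj₁ rs os) (cong (keys ++_) keys-os)))
      (Unique.++⁺ keys! (Unique.filter⁺ (_∉? keys) {ws} ws!) λ (x∈keys , x∈others) →
        proj₂ (∈-filter⁻ (_∉? keys) {xs = ws} x∈others) x∈keys)
    degree≤ : D + length others ≤ q
    degree≤ = subst (_≤ q) (trans (cong sum (map-++ (length ∘ proj₂) rs os))
                             (trans (sum-++ (map (length ∘ proj₂) rs) _) (cong (D +_) degree-os)))
                (totalDegree≤ cM+1 (rs ++ os) unique-keys (All.++⁺ rows rows-os))
    ws⊆ : All (_∈ keys ++ others) ws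
    ws⊆ = All.tabulate λ {x} x∈ws → case x ∈? keys of λ where
      (yes x∈keys) → ∈-++⁺ˡ x∈keys
      (no  x∉keys) → ∈-++⁺ʳ keys (∈-filter⁺ (_∉? keys) x∈ws x∉keys)
    covered : length ws ≤ length rs + length others
    covered = subst (length ws ≤_) (trans (length-++ keys) (cong (_+ length others) (length-map proj₁ rs)))
                (Unique-⊆⇒length≤ ws! ws⊆)

ExcessBounded : ∀ {k} → ConfSet k → ℕ → Set
ExcessBounded X b = ∀ M rs → Unique (map proj₁ rs) → All (FollowersAt X M) rs →
                    totalDegree rs ≤ b + length rs

excessBounded : ∀ {k} {X : ConfSet k} b →
  (∀ M → ∃₂ λ p q → Complexity X M p × Complexity X (suc M) q × q ≤ b + p) → ExcessBounded X b
excessBounded {X = X} b jump M rs keys! rows =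
  let p , q , cM , cM+1 , q≤b+p = jump M in
  +-cancelˡ-≤ p _ _ (begin
    p + totalDegree rs  ≤⟨ excess≤ X cM cM+1 rs keys! rows ⟩
    q + length rs         ≤⟨ +-monoˡ-≤ (length rs) q≤b+p ⟩
    (b + p) + length rs   ≡⟨ cong (_+ length rs) (+-comm b p) ⟩
    (p + b) + length rs   ≡⟨ +-assoc p b (length rs) ⟩
    p + (b + length rs)   ∎)
  where open ≤-Reasoning

module _ {A : Set} where

  Children : (List A → Set) → List A → List A → Set
  Children C p as = Unique as × All (λ a → ∃ λ s → C (p ++ a ∷ s)) as

  Incomparable : List A → List A → Set
  Incomparable w₁ w₂ = (∀ t → w₁ ++ t ≢ w₂) × (∀ t → w₂ ++ t ≢ w₁)

  record Fork (w₁ w₂ : List A) : Set where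
    constructor mkFork
    field
      stem        : List A
      left right  : A
      left≢right  : left ≢ right
      rest₁ rest₂ : List A
      w₁≡         : w₁ ≡ stem ++ left ∷ rest₁
      w₂≡         : w₂ ≡ stem ++ right ∷ rest₂

  incomparable⇒Fork : DecidableEquality A → ∀ w₁ w₂ → Incomparable w₁ w₂ → Fork w₁ w₂
  incomparable⇒Fork _≟_ []       w₂       (w₁⋢w₂ , _) = ⊥-elim (w₁⋢w₂ w₂ refl)
  incomparable⇒Fork _≟_ (a ∷ w₁) []       (_ , w₂⋢w₁) = ⊥-elim (w₂⋢w₁ (a ∷ w₁) refl)
  incomparable⇒Fork _≟_ (a ∷ w₁) (b ∷ w₂) (w₁⋢w₂ , w₂⋢w₁) with a ≟ b
  ... | no a≢b = mkFork [] a b a≢b w₁ w₂ refl refl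
  ... | yes refl =
    let mkFork p x y x≢y s₁ s₂ e₁ e₂ =
          incomparable⇒Fork _≟_ w₁ w₂ ((λ t → w₁⋢w₂ t ∘ cong (a ∷_)) , (λ t → w₂⋢w₁ t ∘ cong (a ∷_)))
    in mkFork (a ∷ p) x y x≢y s₁ s₂ (cong (a ∷_) e₁) (cong (a ∷_) e₂)

  same-stem⇒same-letter : ∀ (p : List A) {w a b s s′} → w ≡ p ++ a ∷ s → w ≡ p ++ b ∷ s′ → a ≡ b
  same-stem⇒same-letter p e e′ = ∷-injectiveˡ (++-cancelˡ p _ _ (trans (sym e) e′))

module PrefixCode {A : Set} (_≟_ : DecidableEquality A) {C : List A → Set}
  (nonempty : ¬ C [])
  (prefix-free : ∀ {w a t} → C w → ¬ C (w ++ a ∷ t))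
  (root-children≤3 : ∀ {as} → Children C [] as → length as ≤ 3)
  (inner-children≤2 : ∀ {c p a as} → Children C (c ∷ p) (a ∷ as) → length (a ∷ as) ≤ 2)
  (root+inner≤4 : ∀ {as c p b bs} → Children C [] as → Children C (c ∷ p) (b ∷ bs) →
                  length as + length (b ∷ bs) ≤ 4)
  (inner+inner≤3 : ∀ {c p d q a as b bs} → c ∷ p ≢ d ∷ q →
                   Children C (c ∷ p) (a ∷ as) → Children C (d ∷ q) (b ∷ bs) →
                   length (a ∷ as) + length (b ∷ bs) ≤ 3)
  where

  open Fork

  incomparable : ∀ {w₁ w₂} → C w₁ → C w₂ → w₁ ≢ w₂ → Incomparable w₁ w₂
  incomparable c₁ c₂ w₁≢w₂ = not-prefix c₁ c₂ w₁≢w₂ , not-prefix c₂ c₁ (≢-sym w₁≢w₂)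
    where
    not-prefix : ∀ {w₁ w₂} → C w₁ → C w₂ → w₁ ≢ w₂ → ∀ t → w₁ ++ t ≢ w₂
    not-prefix {w₁} _  _  w₁≢w₂ []      e    = w₁≢w₂ (trans (sym (++-identityʳ w₁)) e)
    not-prefix      c₁ c₂ _     (_ ∷ _) refl = prefix-free c₁ c₂

  tailFork : ∀ {c t₁ t₂} → C (c ∷ t₁) → C (c ∷ t₂) → c ∷ t₁ ≢ c ∷ t₂ → Fork t₁ t₂
  tailFork {c} c₁ c₂ n₁₂ =
    let w₁⋢w₂ , w₂⋢w₁ = incomparable c₁ c₂ n₁₂ in
    incomparable⇒Fork _≟_ _ _ ((λ t → w₁⋢w₂ t ∘ cong (c ∷_)) , (λ t → w₂⋢w₁ t ∘ cong (c ∷_)))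

  child : ∀ {c t p a s} → C (c ∷ t) → t ≡ p ++ a ∷ s → ∃ λ s → C ((c ∷ p) ++ a ∷ s)
  child cw refl = _ , cw

  fork-Children : ∀ {c t₁ t₂} → C (c ∷ t₁) → C (c ∷ t₂) → (f : Fork t₁ t₂) →
                  Children C (c ∷ stem f) (left f ∷ right f ∷ [])
  fork-Children c₁ c₂ (mkFork _ _ _ a≢b _ _ e₁ e₂) = ((a≢b ∷ []) ∷ [] ∷ []) , child c₁ e₁ ∷ child c₂ e₂ ∷ []

  distinct-inner-forks : ∀ {c p d q a b a′ b′} → c ∷ p ≢ d ∷ q →
    Children C (c ∷ p) (a ∷ b ∷ []) → Children C (d ∷ q) (a′ ∷ b′ ∷ []) → ⊥
  distinct-inner-forks ne ch ch′ = 1+n≰n (inner+inner≤3 ne ch ch′)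

  three-forks : ∀ {c t₁ t₂ t₃} → C (c ∷ t₁) → C (c ∷ t₂) → C (c ∷ t₃) →
                Fork t₁ t₂ → Fork t₁ t₃ → Fork t₂ t₃ → ⊥
  three-forks c₁ c₂ c₃ f₁₂ f₁₃ f₂₃ with ≡-dec _≟_ (stem f₁₂) (stem f₁₃)
  ... | no p≢q = distinct-inner-forks (p≢q ∘ ∷-injectiveʳ) (fork-Children c₁ c₂ f₁₂) (fork-Children c₁ c₃ f₁₃)
  three-forks c₁ c₂ c₃ (mkFork p a b a≢b _ _ e₁ e₂) (mkFork _ a′ b′ a′≢b′ _ _ e₁′ e₃)
              (mkFork r x y x≢y _ _ e₂′ e₃′)
    | yes refl with b′ ≟ b
  ... | no b′≢b =
    1+n≰n (inner-children≤2
      (((a≢b ∷ subst (_≢ b′) (sym (same-stem⇒same-letter p e₁ e₁′)) a′≢b′ ∷ []) ∷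
         (≢-sym b′≢b ∷ []) ∷ [] ∷ []) ,
       child c₁ e₁ ∷ child c₂ e₂ ∷ child c₃ e₃ ∷ []))
  ... | yes refl with ≡-dec _≟_ r p
  ... | yes refl = x≢y (trans (same-stem⇒same-letter r e₂′ e₂) (sym (same-stem⇒same-letter r e₃′ e₃)))
  ... | no r≢p = distinct-inner-forks (r≢p ∘ ∷-injectiveʳ)
                   (fork-Children c₂ c₃ (mkFork r x y x≢y _ _ e₂′ e₃′))
                   (fork-Children c₁ c₂ (mkFork p a b a≢b _ _ e₁ e₂))

  three-with-head : ∀ {c t₁ t₂ t₃} → C (c ∷ t₁) → C (c ∷ t₂) → C (c ∷ t₃) →
    c ∷ t₁ ≢ c ∷ t₂ → c ∷ t₁ ≢ c ∷ t₃ → c ∷ t₂ ≢ c ∷ t₃ → ⊥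
  three-with-head c₁ c₂ c₃ n₁₂ n₁₃ n₂₃ =
    three-forks c₁ c₂ c₃ (tailFork c₁ c₂ n₁₂) (tailFork c₁ c₃ n₁₃) (tailFork c₂ c₃ n₂₃)

  two-pairs : ∀ {c d t₁ t₂ t₃ t₄} → C (c ∷ t₁) → C (c ∷ t₂) → C (d ∷ t₃) → C (d ∷ t₄) →
    c ∷ t₁ ≢ c ∷ t₂ → d ∷ t₃ ≢ d ∷ t₄ → c ≢ d → ⊥
  two-pairs c₁ c₂ c₃ c₄ n₁₂ n₃₄ c≢d =
    distinct-inner-forks (c≢d ∘ ∷-injectiveˡ)
      (fork-Children c₁ c₂ (tailFork c₁ c₂ n₁₂)) (fork-Children c₃ c₄ (tailFork c₃ c₄ n₃₄))

  pair-and-two-heads : ∀ {c d e t₁ t₂ t₃ t₄} → C (c ∷ t₁) → C (c ∷ t₂) → C (d ∷ t₃) → C (e ∷ t₄) →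
    c ∷ t₁ ≢ c ∷ t₂ → c ≢ d → c ≢ e → d ≢ e → ⊥
  pair-and-two-heads {t₁ = t₁} {t₃ = t₃} {t₄} c₁ c₂ c₃ c₄ n₁₂ c≢d c≢e d≢e =
    1+n≰n (root+inner≤4 (((c≢d ∷ c≢e ∷ []) ∷ (d≢e ∷ []) ∷ [] ∷ []) , (t₁ , c₁) ∷ (t₃ , c₃) ∷ (t₄ , c₄) ∷ [])
                        (fork-Children c₁ c₂ (tailFork c₁ c₂ n₁₂)))

  pair-and-two-others : ∀ {c d e t₁ t₂ t₃ t₄} → C (c ∷ t₁) → C (c ∷ t₂) → C (d ∷ t₃) → C (e ∷ t₄) →
    c ∷ t₁ ≢ c ∷ t₂ → c ∷ t₁ ≢ d ∷ t₃ → c ∷ t₁ ≢ e ∷ t₄ →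
    c ∷ t₂ ≢ d ∷ t₃ → c ∷ t₂ ≢ e ∷ t₄ → d ∷ t₃ ≢ e ∷ t₄ → ⊥
  pair-and-two-others {c} {d} {e} c₁ c₂ c₃ c₄ n₁₂ n₁₃ n₁₄ n₂₃ n₂₄ n₃₄ with d ≟ c | e ≟ c | d ≟ e
  ... | yes refl | _        | _        = three-with-head c₁ c₂ c₃ n₁₂ n₁₃ n₂₃
  ... | no _     | yes refl | _        = three-with-head c₁ c₂ c₄ n₁₂ n₁₄ n₂₄
  ... | no d≢c   | no _     | yes refl = two-pairs c₁ c₂ c₃ c₄ n₁₂ n₃₄ (≢-sym d≢c)
  ... | no d≢c   | no e≢c   | no d≢e   = pair-and-two-heads c₁ c₂ c₃ c₄ n₁₂ (≢-sym d≢c) (≢-sym e≢c) d≢e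

  no-four : ∀ {h₁ h₂ h₃ h₄ t₁ t₂ t₃ t₄} →
    C (h₁ ∷ t₁) → C (h₂ ∷ t₂) → C (h₃ ∷ t₃) → C (h₄ ∷ t₄) →
    h₁ ∷ t₁ ≢ h₂ ∷ t₂ → h₁ ∷ t₁ ≢ h₃ ∷ t₃ → h₁ ∷ t₁ ≢ h₄ ∷ t₄ →
    h₂ ∷ t₂ ≢ h₃ ∷ t₃ → h₂ ∷ t₂ ≢ h₄ ∷ t₄ → h₃ ∷ t₃ ≢ h₄ ∷ t₄ → ⊥
  no-four {h₁} {h₂} {h₃} {h₄} {t₁} {t₂} {t₃} {t₄} c₁ c₂ c₃ c₄ n₁₂ n₁₃ n₁₄ n₂₃ n₂₄ n₃₄
    with h₁ ≟ h₂ | h₁ ≟ h₃ | h₁ ≟ h₄ | h₂ ≟ h₃ | h₂ ≟ h₄ | h₃ ≟ h₄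
  ... | yes refl | _ | _ | _ | _ | _ = pair-and-two-others c₁ c₂ c₃ c₄ n₁₂ n₁₃ n₁₄ n₂₃ n₂₄ n₃₄
  ... | no _ | yes refl | _ | _ | _ | _ =
    pair-and-two-others c₁ c₃ c₂ c₄ n₁₃ n₁₂ n₁₄ (≢-sym n₂₃) n₃₄ n₂₄
  ... | no _ | no _ | yes refl | _ | _ | _ =
    pair-and-two-others c₁ c₄ c₂ c₃ n₁₄ n₁₂ n₁₃ (≢-sym n₂₄) (≢-sym n₃₄) n₂₃
  ... | no _ | no _ | no _ | yes refl | _ | _ =
    pair-and-two-others c₂ c₃ c₁ c₄ n₂₃ (≢-sym n₁₂) n₂₄ (≢-sym n₁₃) n₃₄ n₁₄
  ... | no _ | no _ | no _ | no _ | yes refl | _ =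
    pair-and-two-others c₂ c₄ c₁ c₃ n₂₄ (≢-sym n₁₂) n₂₃ (≢-sym n₁₄) (≢-sym n₃₄) n₁₃
  ... | no _ | no _ | no _ | no _ | no _ | yes refl =
    pair-and-two-others c₃ c₄ c₁ c₂ n₃₄ (≢-sym n₁₃) (≢-sym n₂₃) (≢-sym n₁₄) (≢-sym n₂₄) n₁₂
  ... | no h₁≢h₂ | no h₁≢h₃ | no h₁≢h₄ | no h₂≢h₃ | no h₂≢h₄ | no h₃≢h₄ =
    1+n≰n (root-children≤3
      (((h₁≢h₂ ∷ h₁≢h₃ ∷ h₁≢h₄ ∷ []) ∷ (h₂≢h₃ ∷ h₂≢h₄ ∷ []) ∷ (h₃≢h₄ ∷ []) ∷ [] ∷ []) ,
       (t₁ , c₁) ∷ (t₂ , c₂) ∷ (t₃ , c₃) ∷ (t₄ , c₄) ∷ []))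

  length≤3 : ∀ ws → Unique ws → All C ws → length ws ≤ 3
  length≤3 []                     _ _ = z≤n
  length≤3 (_ ∷ [])               _ _ = s≤s z≤n
  length≤3 (_ ∷ _ ∷ [])           _ _ = s≤s (s≤s z≤n)
  length≤3 (_ ∷ _ ∷ _ ∷ [])       _ _ = s≤s (s≤s (s≤s z≤n))
  length≤3 ([] ∷ _ ∷ _ ∷ _ ∷ _)   _ (c ∷ _)             = ⊥-elim (nonempty c)
  length≤3 (_ ∷ [] ∷ _ ∷ _ ∷ _)   _ (_ ∷ c ∷ _)         = ⊥-elim (nonempty c)
  length≤3 (_ ∷ _ ∷ [] ∷ _ ∷ _)   _ (_ ∷ _ ∷ c ∷ _)     = ⊥-elim (nonempty c)
  length≤3 (_ ∷ _ ∷ _ ∷ [] ∷ _)   _ (_ ∷ _ ∷ _ ∷ c ∷ _) = ⊥-elim (nonempty c)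
  length≤3 ((_ ∷ _) ∷ (_ ∷ _) ∷ (_ ∷ _) ∷ (_ ∷ _) ∷ _)
           ((n₁₂ ∷ n₁₃ ∷ n₁₄ ∷ _) ∷ (n₂₃ ∷ n₂₄ ∷ _) ∷ (n₃₄ ∷ _) ∷ _) (c₁ ∷ c₂ ∷ c₃ ∷ c₄ ∷ _) =
    ⊥-elim (no-four c₁ c₂ c₃ c₄ n₁₂ n₁₃ n₁₄ n₂₃ n₂₄ n₃₄)

module Circuits {k} {X : ConfSet k} (excess : ExcessBounded X 2) {n} {u : Word k} (|u|≡n : length u ≡ n)
  (V : ℕ → Word k) (V-special : ∀ m → RightSpecial X (V m)) (|V|≡ : ∀ m → length (V m) ≡ n + m)
  (u-suffix-V : ∀ m → ∃ λ v → v ++ u ≡ V m)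
  where

  Circuit : Word k → Set
  Circuit = AllowedCircuit X n u

  nonempty : ¬ Circuit []
  nonempty (_ , _ , _ , () , _)

  interior : ∀ {w} → Circuit w → ∀ i → 1 ≤ i → i < length w → vertex u w i ≢ u
  interior (_ , _ , _ , _ , _ , _ , int , _) = int

  allowed : ∀ {w} → Circuit w → Lang X (u ++ w)
  allowed (_ , _ , _ , _ , _ , _ , _ , L) = L

  length-u++ : ∀ p → length (u ++ p) ≡ n + length p
  length-u++ p = trans (length-++ u) (cong (_+ length p) |u|≡n)

  -- An occurrence of u at a position j ≥ 1 of u p is a return of the circuit to u after j steps,
  -- before its end.
  only-initial-occurrence : ∀ {p a s} z {q} → Circuit (p ++ a ∷ s) → z ++ u ++ q ≡ u ++ p → z ≡ []
  only-initial-occurrence {a = a} {s} z {q} circuit eq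
    with levi (z ++ u) u (trans (++-assoc z u q) eq) (length-++-≤ʳ u {z})
  ... | [] , z++u≡u , _ = ++-identityˡ-unique z (sym (trans z++u≡u (++-identityʳ u)))
  ... | w@(_ ∷ _) , z++u≡u++w , refl =
    ⊥-elim (interior circuit (length w) (s≤s z≤n) (length-<-++ w q) vertex≡u)
    where
    vertex≡u : vertex u ((w ++ q) ++ a ∷ s) (length w) ≡ u
    vertex≡u = begin
      drop (length w) (u ++ take (length w) ((w ++ q) ++ a ∷ s))
        ≡⟨ cong (λ x → drop (length w) (u ++ take (length w) x)) (++-assoc w q (a ∷ s)) ⟩
      drop (length w) (u ++ take (length w) (w ++ q ++ a ∷ s))
        ≡⟨ cong (λ x → drop (length w) (u ++ x)) (take-length-++ w) ⟩
      drop (length w) (u ++ w)  ≡⟨ cong (drop (length w)) z++u≡u++w ⟨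
      drop (length w) (z ++ u)  ≡⟨ cong (λ j → drop j (z ++ u)) (conjugate⇒same-length {z = z} z++u≡u++w) ⟩
      drop (length z) (z ++ u)  ≡⟨ drop-length-++ z ⟩
      u                         ∎
      where open ≡-Reasoning

  not-suffix : ∀ {p a s} v → Circuit (p ++ a ∷ s) → v ++ u ≡ u ++ p → p ≡ []
  not-suffix v circuit eq
    with refl ← only-initial-occurrence v circuit (trans (cong (v ++_) (++-identityʳ u)) eq)
    = ++-identityʳ-unique u eq

  inner-not-suffix : ∀ {c p a s} v → Circuit ((c ∷ p) ++ a ∷ s) → v ++ u ≢ u ++ c ∷ p
  inner-not-suffix v circuit eq with () ← not-suffix v circuit eq

  inner≢V : ∀ {c p a s} m → Circuit ((c ∷ p) ++ a ∷ s) → u ++ c ∷ p ≢ V m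
  inner≢V m circuit eq = let v , v++u≡V = u-suffix-V m in inner-not-suffix v circuit (trans v++u≡V (sym eq))

  ends-with-u : ∀ {w} → Circuit w → ∃ λ z → z ++ u ≡ u ++ w
  ends-with-u {w} (_ , _ , _ , _ , _ , returns , _) =
    take (length w) (u ++ w) ,
    trans (cong (take (length w) (u ++ w) ++_) (sym returns′)) (take++drop≡id (length w) (u ++ w))
    where
    returns′ : drop (length w) (u ++ w) ≡ u
    returns′ = trans (cong (λ x → drop (length w) (u ++ x)) (sym (take-all (length w) w ≤-refl))) returns

  prefix-free : ∀ {w a t} → Circuit w → ¬ Circuit (w ++ a ∷ t)
  prefix-free circuit circuit′ =
    let z , z++u≡u++w = ends-with-u circuit
    in nonempty (subst Circuit (not-suffix z circuit′ z++u≡u++w) circuit)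

  children-Followers : ∀ {p as} → Children Circuit p as → Followers X (u ++ p) as
  children-Followers {p} (as! , children) = as! , All.map prefix-Lang children
    where
    prefix-Lang : ∀ {a} → (∃ λ s → Circuit (p ++ a ∷ s)) → Lang X ((u ++ p) ∷ʳ a)
    prefix-Lang {a} (s , circuit) =
      proj₁ (Lang-++⁻ X ((u ++ p) ∷ʳ a)
        (subst (Lang X) (trans (sym (++-assoc u p (a ∷ s))) (sym (∷ʳ-++ (u ++ p) a s))) (allowed circuit)))

  suffix-at-level : ∀ {m} p → m ≤ length p → ∃₂ λ z y → z ++ y ≡ u ++ p × length y ≡ n + m
  suffix-at-level p m≤|p| = suffix-of-length (u ++ p) (subst (_ ≤_) (sym (length-u++ p)) (+-monoʳ-≤ n m≤|p|))

  suffix-Followers : ∀ {p as z y} → z ++ y ≡ u ++ p → Children Circuit p as → Followers X y as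
  suffix-Followers {as = as} {z} z++y≡ ch =
    Followers-suffix X z (subst (λ x → Followers X x as) (sym z++y≡) (children-Followers ch))

  root-children≤3 : ∀ {as} → Children Circuit [] as → length as ≤ 3
  root-children≤3 {as} ch =
    subst (_≤ 3) (+-identityʳ (length as))
      (excess (n + 0) ((u ++ [] , as) ∷ []) ([] ∷ []) ((length-u++ [] , children-Followers ch) ∷ []))

  inner-children≤2 : ∀ {c p a as} → Children Circuit (c ∷ p) (a ∷ as) → length (a ∷ as) ≤ 2
  inner-children≤2 {c} {p} {a} {as} ch@(_ , (_ , circuit) ∷ _) =
    +-cancelʳ-≤ 2 (length (a ∷ as)) 2
      (excess (n + m) ((u ++ c ∷ p , a ∷ as) ∷ (V m , specialFollowers X (V-special m)) ∷ [])
        ((inner≢V m circuit ∷ []) ∷ [] ∷ [])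
        ((length-u++ (c ∷ p) , children-Followers ch) ∷ (|V|≡ m , special-Followers X (V-special m)) ∷ []))
    where m = length (c ∷ p)

  root+inner≤4 : ∀ {as c p b bs} → Children Circuit [] as → Children Circuit (c ∷ p) (b ∷ bs) →
                 length as + length (b ∷ bs) ≤ 4
  root+inner≤4 {as} {c} {p} {b} {bs} root inner@(_ , (_ , circuit) ∷ _)
    with z , y , z++y≡ , |y| ← suffix-at-level {0} (c ∷ p) z≤n =
    subst (_≤ 4) (cong (length as +_) (+-identityʳ (length (b ∷ bs))))
      (excess (n + 0) ((u ++ [] , as) ∷ (y , b ∷ bs) ∷ [])
        ((u≢y ∷ []) ∷ [] ∷ [])
        ((length-u++ [] , children-Followers root) ∷ (|y| , suffix-Followers z++y≡ inner) ∷ []))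
    where
    u≢y : u ++ [] ≢ y
    u≢y eq = inner-not-suffix z circuit (trans (cong (z ++_) (trans (sym (++-identityʳ u)) eq)) z++y≡)

  shorter+longer≤3 : ∀ {c p d q a as b bs} → c ∷ p ≢ d ∷ q →
    Children Circuit (c ∷ p) (a ∷ as) → Children Circuit (d ∷ q) (b ∷ bs) → length (c ∷ p) ≤ length (d ∷ q) →
    length (a ∷ as) + length (b ∷ bs) ≤ 3
  shorter+longer≤3 {c} {p} {d} {q} {a} {as} {b} {bs} c∷p≢d∷q short@(_ , (_ , circuit) ∷ _)
                   long@(_ , (_ , circuit′) ∷ _) m≤
    with z , y , z++y≡ , |y| ← suffix-at-level (d ∷ q) m≤ =
    +-cancelʳ-≤ 2 (length (a ∷ as) + length (b ∷ bs)) 3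
      (subst (_≤ 5) (sym (+-assoc (length (a ∷ as)) (length (b ∷ bs)) 2))
        (excess (n + m) ((u ++ c ∷ p , a ∷ as) ∷ (y , b ∷ bs) ∷ (V m , specialFollowers X (V-special m)) ∷ [])
          ((short≢y ∷ inner≢V m circuit ∷ []) ∷ (y≢V ∷ []) ∷ [] ∷ [])
          ((length-u++ (c ∷ p) , children-Followers short) ∷ (|y| , suffix-Followers z++y≡ long) ∷
           (|V|≡ m , special-Followers X (V-special m)) ∷ [])))
    where
    m = length (c ∷ p)
    short≢y : u ++ c ∷ p ≢ y
    short≢y eq =
      let z≡[] = only-initial-occurrence z circuit′ (trans (cong (z ++_) eq) z++y≡)
      in c∷p≢d∷q (++-cancelˡ u _ _ (trans eq (trans (cong (_++ y) (sym z≡[])) z++y≡)))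
    y≢V : y ≢ V m
    y≢V eq =
      let v , v++u≡V = u-suffix-V m
      in inner-not-suffix (z ++ v) circuit′
           (trans (++-assoc z v u) (trans (cong (z ++_) (trans v++u≡V (sym eq))) z++y≡))

  inner+inner≤3 : ∀ {c p d q a as b bs} → c ∷ p ≢ d ∷ q →
    Children Circuit (c ∷ p) (a ∷ as) → Children Circuit (d ∷ q) (b ∷ bs) →
    length (a ∷ as) + length (b ∷ bs) ≤ 3
  inner+inner≤3 {c} {p} {d} {q} {a} {as} {b} {bs} ne ch ch′ with ≤-total (length (c ∷ p)) (length (d ∷ q))
  ... | inj₁ shorter = shorter+longer≤3 ne ch ch′ shorter
  ... | inj₂ longer  =
    subst (_≤ 3) (+-comm (length (b ∷ bs)) (length (a ∷ as))) (shorter+longer≤3 (≢-sym ne) ch′ ch longer)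

proposition4p6 : (k : ℕ) (X : ConfSet k) → IsMinimalSubshift X →
    (∀ n → Σ ℕ λ p → Σ ℕ λ q →
       Complexity X n p × Complexity X (suc n) q × 1 + p ≤ q × q ≤ 2 + p) →
    (N : ℕ) (U : ℕ → Word k) →
    (∀ n → N ≤ n → RightSpecial X (U n) × length (U n) ≡ n) →
    (∀ n → N ≤ n → ∃ λ v → v ++ U n ≡ U (suc n)) →
    ∀ n → N ≤ n → (cs : List (Word k)) → Unique cs →
    All (AllowedCircuit X n (U n)) cs → length cs ≤ 3
proposition4p6 k X _ growth N U special-chain suffix-chain-step n N≤n =
  PrefixCode.length≤3 Fin._≟_ nonempty prefix-free root-children≤3 inner-children≤2 root+inner≤4 inner+inner≤3
  where
  N≤m+n : ∀ m → N ≤ m + n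
  N≤m+n m = ≤-trans N≤n (m≤n+m n m)

  excess : ExcessBounded X 2
  excess = excessBounded 2 λ M → let p , q , cM , cM+1 , _ , q≤2+p = growth M in p , q , cM , cM+1 , q≤2+p

  open Circuits excess (proj₂ (special-chain n N≤n)) (λ m → U (m + n))
    (λ m → proj₁ (special-chain (m + n) (N≤m+n m)))
    (λ m → trans (proj₂ (special-chain (m + n) (N≤m+n m))) (+-comm m n))
    (suffix-chain U n (λ m → suffix-chain-step (m + n) (N≤m+n m)))
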